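{- Define integer sequences by $s_1=2$, $s_{n+1}=1+(2^{2^n}-1)s_n$ for $n\ge1$, and $w_1=1$, $w_{n+1}=2^{2^n}-1+(2^{2^n}-1)w_n$ for $n\ge1$. Let $F_n=2^{2^n}+1$ and let $\tau=\sum_{n=0}^{\infty}t(n)\,2^{ -(n+1)}=0.4124540336\ldots$ be the Thue–Morse constant. Then for every $n\ge1$, $$\frac{w_n}{F_n-1}<\frac{s_n}{F_n}<\tau.$$
   Context: $t(n)$ is the Thue–Morse sequence: $t(n)=0$ if the binary expansion of $n$ has an even number of $1$'s, $t(n)=1$ otherwise. -}

module Defs where

open import Data.Nat using (ℕ; zero; suc; _+_; _*_; _∸_; _^_; _%_; _/_; NonZero)
open import Data.Nat.Properties using (m^n≢0)
open import Data.Integer using (+_)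
open import Data.Rational using (ℚ; 0ℚ) renaming (_/_ to _/ℚ_; _+_ to _+ℚ_; _*_ to _*ℚ_)

onesAux : ℕ → ℕ → ℕ
onesAux zero    m = 0
onesAux (suc f) m = m % 2 + onesAux f (m / 2)

-- fuel n suffices since n < 2^n
ones : ℕ → ℕ
ones n = onesAux n n

t : ℕ → ℕ
t n = ones n % 2

E : ℕ → ℕ
E n = 2 ^ (2 ^ n)

E-nonZero : ∀ n → NonZero (E n)
E-nonZero n = m^n≢0 2 (2 ^ n)

F : ℕ → ℕ
F n = suc (E n)

-- s 1 = 2, s (n+1) = 1 + (2^(2^n) - 1) s n ; s 0 is an unused dummy value
s : ℕ → ℕ
s zero = 0
s (suc zero) = 2
s (suc (suc n)) = 1 + (E (suc n) ∸ 1) * s (suc n)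

-- w 1 = 1, w (n+1) = 2^(2^n) - 1 + (2^(2^n) - 1) w n ; w 0 is an unused dummy value
w : ℕ → ℕ
w zero = 0
w (suc zero) = 1
w (suc (suc n)) = (E (suc n) ∸ 1) + (E (suc n) ∸ 1) * w (suc n)

τPartial : ℕ → ℚ
τPartial zero    = 0ℚ
τPartial (suc N) = τPartial N +ℚ (_/ℚ_ (+ t N) (2 ^ suc N) {{m^n≢0 2 (suc N)}})

-- w n / (F n - 1)   (note F n - 1 = E n)
wRatio : ℕ → ℚ
wRatio n = _/ℚ_ (+ w n) (F n ∸ 1) {{E-nonZero n}}

sRatio : ℕ → ℚ
sRatio n = (+ s n) /ℚ (F n)

-- Let E = 2^(2^n) = F_n − 1 and let u be the number whose binary digits are the
-- first 2^n Thue–Morse bits.  Since t(2^n + j) = 1 − t(j) for j < 2^n, the next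
-- 2^n bits spell the complement ū = E − 1 − u, so the prefix of length 2^(n+1)
-- is u E + ū = (E − 1)(u + 1): this is the recurrence of w, whence w_n = u and
-- s_n = u + 1.  The first inequality is u/E < (u + 1)/(E + 1), i.e. u < E.  The
-- bits t(2^(n+1) + j) are again complementary to t(j), so the prefix of length
-- 3·2^n gives τ > ((u E + ū) E + ū)/E³; clearing denominators, this exceeds
-- (u + 1)/(E + 1) because u < ū, which holds as t(0) = 0 forces u < E/2.
module Submission where

open import Defs
open import Data.Nat using (ℕ; suc; _≤_; _^_)
import Data.Nat as ℕ

module Digits where

  open import Data.Nat
  open import Data.Nat.Properties
  open import Data.Nat.DivMod
  open import Data.Nat.Divisibility using (divides-refl)
  open import Data.Sum using (inj₁; inj₂)
  open import Relation.Binary.PropositionalEquality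

  n<2^n : ∀ n → n < 2 ^ n
  n<2^n zero    = z<s
  n<2^n (suc n) = +-mono-≤ (m^n>0 2 n) (≤-trans (n<2^n n) (m≤m+n (2 ^ n) 0))

  [m*2+k]%2≡k%2 : ∀ m k → (m * 2 + k) % 2 ≡ k % 2
  [m*2+k]%2≡k%2 m k = trans (cong (_% 2) (+-comm (m * 2) k)) ([m+kn]%n≡m%n k m 2)

  [m*2+k]/2≡m+k/2 : ∀ m k → (m * 2 + k) / 2 ≡ m + k / 2
  [m*2+k]/2≡m+k/2 m k = trans (+-distrib-/-∣ˡ k (divides-refl m)) (cong (_+ k / 2) (m*n/n≡m m 2))

  [1+m]%2+m%2≡1 : ∀ m → suc m % 2 + m % 2 ≡ 1
  [1+m]%2+m%2≡1 zero          = refl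
  [1+m]%2+m%2≡1 (suc zero)    = refl
  [1+m]%2+m%2≡1 (suc (suc m)) = [1+m]%2+m%2≡1 m

  onesAux-zero : ∀ f → onesAux f 0 ≡ 0
  onesAux-zero zero    = refl
  onesAux-zero (suc f) = onesAux-zero f

  onesAux-+-fuel : ∀ f d {m} → m < 2 ^ f → onesAux (f + d) m ≡ onesAux f m
  onesAux-+-fuel zero    d {zero}  _          = onesAux-zero d
  onesAux-+-fuel zero    d {suc m} (s≤s ())
  onesAux-+-fuel (suc f) d {m}     m<2^1+f =
    cong (m % 2 +_) (onesAux-+-fuel f d (m<n*o⇒m/o<n (subst (m <_) (*-comm 2 (2 ^ f)) m<2^1+f)))

  onesAux-fuel-irrelevant : ∀ f g {m} → m < 2 ^ f → m < 2 ^ g → onesAux f m ≡ onesAux g m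
  onesAux-fuel-irrelevant f g {m} m<2^f m<2^g with ≤-total f g
  ... | inj₁ f≤g = trans (sym (onesAux-+-fuel f (g ∸ f) m<2^f)) (cong (λ h → onesAux h m) (m+[n∸m]≡n f≤g))
  ... | inj₂ g≤f = trans (cong (λ h → onesAux h m) (sym (m+[n∸m]≡n g≤f))) (onesAux-+-fuel g (f ∸ g) m<2^g)

  ones≡onesAux : ∀ f {m} → m < 2 ^ f → ones m ≡ onesAux f m
  ones≡onesAux f {m} = onesAux-fuel-irrelevant m f (n<2^n m)

  onesAux-2^n+ : ∀ n {k} → k < 2 ^ n → onesAux (suc n) (2 ^ n + k) ≡ suc (onesAux n k)
  onesAux-2^n+ zero    {zero}  _ = refl
  onesAux-2^n+ zero    {suc k} (s≤s ())
  onesAux-2^n+ (suc n) {k} k<2^1+n = begin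
    onesAux (2 + n) (2 ^ suc n + k)
      ≡⟨ cong (λ x → onesAux (2 + n) (x + k)) (*-comm 2 (2 ^ n)) ⟩
    (2 ^ n * 2 + k) % 2 + onesAux (suc n) ((2 ^ n * 2 + k) / 2)
      ≡⟨ cong₂ _+_ ([m*2+k]%2≡k%2 (2 ^ n) k) (cong (onesAux (suc n)) ([m*2+k]/2≡m+k/2 (2 ^ n) k)) ⟩
    k % 2 + onesAux (suc n) (2 ^ n + k / 2)
      ≡⟨ cong (k % 2 +_) (onesAux-2^n+ n k/2<2^n) ⟩
    k % 2 + suc (onesAux n (k / 2))
      ≡⟨ +-suc (k % 2) _ ⟩
    suc (onesAux (suc n) k)
      ∎
    where
    open ≡-Reasoning
    k/2<2^n : k / 2 < 2 ^ n
    k/2<2^n = m<n*o⇒m/o<n (subst (k <_) (*-comm 2 (2 ^ n)) k<2^1+n)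

  t≤1 : ∀ k → t k ≤ 1
  t≤1 k = s≤s⁻¹ (m%n<n (ones k) 2)

  t-2^n+ : ∀ n {k} → k < 2 ^ n → t (2 ^ n + k) + t k ≡ 1
  t-2^n+ n {k} k<2^n = begin
    ones (2 ^ n + k) % 2 + ones k % 2      ≡⟨ cong₂ (λ a b → a % 2 + b % 2) ones-2^n+k (ones≡onesAux n k<2^n) ⟩
    suc (onesAux n k) % 2 + onesAux n k % 2 ≡⟨ [1+m]%2+m%2≡1 (onesAux n k) ⟩
    1                                       ∎
    where
    open ≡-Reasoning
    2^n+k<2^1+n : 2 ^ n + k < 2 ^ suc n
    2^n+k<2^1+n = subst (2 ^ n + k <_) (cong (2 ^ n +_) (sym (+-identityʳ (2 ^ n)))) (+-monoʳ-< (2 ^ n) k<2^n)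
    ones-2^n+k : ones (2 ^ n + k) ≡ suc (onesAux n k)
    ones-2^n+k = trans (ones≡onesAux (suc n) 2^n+k<2^1+n) (onesAux-2^n+ n k<2^n)

module Words where

  open import Data.Nat
  open import Data.Nat.Properties
  open import Data.Nat.Tactic.RingSolver using (solve-∀)
  open import Relation.Binary.PropositionalEquality
  open Digits

  tmWord : ℕ → ℕ → ℕ
  tmWord M zero    = 0
  tmWord M (suc k) = 2 * tmWord M k + t (M + k)

  tmWord-++ : ∀ M k l → tmWord M (k + l) ≡ tmWord M k * 2 ^ l + tmWord (M + k) l
  tmWord-++ M k zero = begin
    tmWord M (k + 0)         ≡⟨ cong (tmWord M) (+-identityʳ k) ⟩
    tmWord M k               ≡⟨ sym (trans (+-identityʳ _) (*-identityʳ _)) ⟩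
    tmWord M k * 1 + 0       ∎
    where open ≡-Reasoning
  tmWord-++ M k (suc l) = begin
    tmWord M (k + suc l)                               ≡⟨ cong (tmWord M) (+-suc k l) ⟩
    2 * tmWord M (k + l) + t (M + (k + l))             ≡⟨ cong₂ (λ x y → 2 * x + t y) (tmWord-++ M k l) (sym (+-assoc M k l)) ⟩
    2 * (a * 2 ^ l + b) + t (M + k + l)                ≡⟨ cong (_+ t (M + k + l)) (double-shift a (2 ^ l) b) ⟩
    a * (2 * 2 ^ l) + 2 * b + t (M + k + l)            ≡⟨ +-assoc (a * (2 * 2 ^ l)) _ _ ⟩
    a * 2 ^ suc l + tmWord (M + k) (suc l)             ∎
    where
    open ≡-Reasoning
    a = tmWord M k
    b = tmWord (M + k) l
    double-shift : ∀ a p b → 2 * (a * p + b) ≡ a * (2 * p) + 2 * b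
    double-shift = solve-∀

  tmWord<2^ : ∀ M k → tmWord M k < 2 ^ k
  tmWord<2^ M zero    = z<s
  tmWord<2^ M (suc k) = begin-strict
    2 * x + t (M + k)  ≤⟨ +-monoʳ-≤ (2 * x) (t≤1 (M + k)) ⟩
    2 * x + 1          ≡⟨ +-comm (2 * x) 1 ⟩
    1 + 2 * x          <⟨ n<1+n _ ⟩
    2 + 2 * x          ≡⟨ *-suc 2 x ⟨
    2 * suc x          ≤⟨ *-monoʳ-≤ 2 (tmWord<2^ M k) ⟩
    2 * 2 ^ k          ∎
    where
    open ≤-Reasoning
    x = tmWord M k

  tmWord-complement : ∀ n k → k ≤ 2 ^ n → suc (tmWord (2 ^ n) k + tmWord 0 k) ≡ 2 ^ k
  tmWord-complement n zero    _     = refl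
  tmWord-complement n (suc k) k<2^n = begin
    suc (2 * a + t (2 ^ n + k) + (2 * b + t k))  ≡⟨ cong suc (regroup a (t (2 ^ n + k)) b (t k)) ⟩
    suc (2 * (a + b) + (t (2 ^ n + k) + t k))    ≡⟨ cong (λ x → suc (2 * (a + b) + x)) (t-2^n+ n k<2^n) ⟩
    suc (2 * (a + b) + 1)                        ≡⟨ suc[2x+1]≡2*suc[x] (a + b) ⟩
    2 * suc (a + b)                              ≡⟨ cong (2 *_) (tmWord-complement n k (<⇒≤ k<2^n)) ⟩
    2 * 2 ^ k                                    ∎
    where
    open ≡-Reasoning
    a = tmWord (2 ^ n) k
    b = tmWord 0 k
    regroup : ∀ a p b q → 2 * a + p + (2 * b + q) ≡ 2 * (a + b) + (p + q)
    regroup = solve-∀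
    suc[2x+1]≡2*suc[x] : ∀ x → suc (2 * x + 1) ≡ 2 * suc x
    suc[2x+1]≡2*suc[x] = solve-∀

  -- t(0) = 0 is a leading zero of the prefix.
  2*[1+tmWord-0]≤2^ : ∀ {P} → 1 ≤ P → 2 * suc (tmWord 0 P) ≤ 2 ^ P
  2*[1+tmWord-0]≤2^ {suc q} _ = *-monoʳ-≤ 2 (subst (_< 2 ^ q) (sym (tmWord-++ 0 1 q)) (tmWord<2^ 1 q))

module Arithmetic where

  open import Data.Nat
  open import Data.Nat.Properties
  open import Data.Nat.Tactic.RingSolver using (solve-∀)
  open import Data.Product using (_,_)
  open import Relation.Binary.PropositionalEquality

  ∸1-recurrence : ∀ {e} c u → suc (c + u) ≡ e → (e ∸ 1) + (e ∸ 1) * u ≡ u * e + c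
  ∸1-recurrence c u refl = identity c u
    where
    identity : ∀ c u → (c + u) + (c + u) * u ≡ u * suc (c + u) + c
    identity = solve-∀

  half-bound⇒< : ∀ {m n k} → suc (n + m) ≡ k → 2 * suc m ≤ k → m < n
  half-bound⇒< {m} {n} refl le = +-cancelʳ-≤ m (suc m) n (s≤s⁻¹ (subst (_≤ suc (n + m)) (identity m n) le))
    where
    identity : ∀ m n → 2 * suc m ≡ suc (suc m + m)
    identity = solve-∀

  m<n⇒m*[1+n]<[1+m]*n : ∀ {m n} → m < n → m * suc n < suc m * n
  m<n⇒m*[1+n]<[1+m]*n {m} {n} m<n = subst (_< suc m * n) (sym (*-suc m n)) (+-monoˡ-< (m * n) m<n)

  cubic-gap : ∀ u d → let c = suc (u + d); e = suc (c + u) in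
              ((u * e + c) * e + c) * suc e ≡ suc u * (e * e * e) + suc (u + d + e * d)
  cubic-gap = solve-∀

  cubic-< : ∀ {u c e} → suc (c + u) ≡ e → u < c → suc u * (e * e * e) < ((u * e + c) * e + c) * suc e
  cubic-< {u} refl u<c with m≤n⇒∃[o]m+o≡n u<c
  ... | d , refl = <-≤-trans (m<m+n _ z<s) (≤-reflexive (sym (cubic-gap u d)))

module Prefix (n : ℕ) where

  open import Data.Nat
  open import Data.Nat.Properties
  open import Relation.Binary.PropositionalEquality
  open Words
  open Arithmetic

  P : ℕ
  P = 2 ^ n

  u ū : ℕ
  u = tmWord 0 P
  ū = tmWord P P

  1+ū+u≡E : suc (ū + u) ≡ E n
  1+ū+u≡E = tmWord-complement n P ≤-refl

  u<ū : u < ū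
  u<ū = half-bound⇒< 1+ū+u≡E (2*[1+tmWord-0]≤2^ (m^n>0 2 n))

  2^[1+n]≡P+P : 2 ^ suc n ≡ P + P
  2^[1+n]≡P+P = cong (P +_) (+-identityʳ P)

  tmWord-2P : tmWord 0 (2 ^ suc n) ≡ u * E n + ū
  tmWord-2P = trans (cong (tmWord 0) 2^[1+n]≡P+P) (tmWord-++ 0 P P)

  tmWord-2P-P : tmWord (2 ^ suc n) P ≡ ū
  tmWord-2P-P = +-cancelʳ-≡ u _ _ (suc-injective (trans (tmWord-complement (suc n) P (m≤m+n P _)) (sym 1+ū+u≡E)))

  tmWord-3P : tmWord 0 (2 ^ suc n + P) ≡ (u * E n + ū) * E n + ū
  tmWord-3P = trans (tmWord-++ 0 (2 ^ suc n) P) (cong₂ (λ a b → a * E n + b) tmWord-2P tmWord-2P-P)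

  u<E : u < E n
  u<E = subst (u <_) 1+ū+u≡E (s≤s (m≤n+m u ū))

  2^3P≡E³ : 2 ^ (2 ^ suc n + P) ≡ E n * E n * E n
  2^3P≡E³ = begin
    2 ^ (2 ^ suc n + P)     ≡⟨ ^-distribˡ-+-* 2 (2 ^ suc n) P ⟩
    2 ^ (2 ^ suc n) * E n   ≡⟨ cong (λ x → 2 ^ x * E n) 2^[1+n]≡P+P ⟩
    2 ^ (P + P) * E n       ≡⟨ cong (_* E n) (^-distribˡ-+-* 2 P P) ⟩
    E n * E n * E n         ∎
    where open ≡-Reasoning

  [1+u]*2^3P<tmWord-3P*F : suc u * 2 ^ (2 ^ suc n + P) < tmWord 0 (2 ^ suc n + P) * F n
  [1+u]*2^3P<tmWord-3P*F =
    subst₂ (λ x y → suc u * x < y * F n) (sym 2^3P≡E³) (sym tmWord-3P) (cubic-< 1+ū+u≡E u<ū)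

module Sequences where

  open import Data.Nat
  open import Data.Nat.Properties
  open import Relation.Binary.PropositionalEquality
  open Words
  open Arithmetic

  w≡tmWord : ∀ m → w (suc m) ≡ tmWord 0 (2 ^ suc m)
  w≡tmWord zero    = refl
  w≡tmWord (suc m) = begin
    (E n ∸ 1) + (E n ∸ 1) * w n  ≡⟨ cong (λ x → (E n ∸ 1) + (E n ∸ 1) * x) (w≡tmWord m) ⟩
    (E n ∸ 1) + (E n ∸ 1) * u    ≡⟨ ∸1-recurrence ū u 1+ū+u≡E ⟩
    u * E n + ū                  ≡⟨ tmWord-2P ⟨
    tmWord 0 (2 ^ suc n)         ∎
    where
    open ≡-Reasoning
    n = suc m
    open Prefix n

  s≡1+w : ∀ m → s (suc m) ≡ suc (w (suc m))
  s≡1+w zero    = refl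
  s≡1+w (suc m) = cong suc (trans (cong ((E (suc m) ∸ 1) *_) (s≡1+w m)) (*-suc (E (suc m) ∸ 1) (w (suc m))))

module Fractions where

  open import Data.Nat as ℕ using (suc; NonZero)
  open import Data.Nat.Properties using (m*n≢0)
  open import Data.Integer as ℤ using (+_)
  open import Data.Integer.Properties using (pos-*; pos-+)
  open import Data.Rational using (_/_; _+_; _<_; toℚᵘ)
  open import Data.Rational.Properties using (toℚᵘ-fromℚᵘ; toℚᵘ-cancel-<; toℚᵘ-injective; toℚᵘ-homo-+)
  import Data.Rational.Unnormalised as ℚᵘ
  import Data.Rational.Unnormalised.Properties as ℚᵘ
  open import Relation.Binary.PropositionalEquality

  toℚᵘ-/ : ∀ i n .{{_ : NonZero n}} → toℚᵘ (i / n) ℚᵘ.≃ (i ℚᵘ./ n)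
  toℚᵘ-/ i (suc n) = toℚᵘ-fromℚᵘ (ℚᵘ.mkℚᵘ i n)

  m*q<n*p⇒m/p<n/q : ∀ m n p q .{{_ : NonZero p}} .{{_ : NonZero q}} →
                    m ℕ.* q ℕ.< n ℕ.* p → + m / p < + n / q
  m*q<n*p⇒m/p<n/q m n p@(suc _) q@(suc _) mq<np =
    toℚᵘ-cancel-< (ℚᵘ.<-respˡ-≃ (ℚᵘ.≃-sym (toℚᵘ-/ (+ m) p)) (ℚᵘ.<-respʳ-≃ (ℚᵘ.≃-sym (toℚᵘ-/ (+ n) q))
      (ℚᵘ.*<* (subst₂ ℤ._<_ (pos-* m q) (pos-* n p) (ℤ.+<+ mq<np)))))

  m*q≡n*p⇒m/p≡n/q : ∀ m n p q .{{_ : NonZero p}} .{{_ : NonZero q}} →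
                    m ℕ.* q ≡ n ℕ.* p → + m / p ≡ + n / q
  m*q≡n*p⇒m/p≡n/q m n p@(suc _) q@(suc _) mq≡np =
    toℚᵘ-injective (ℚᵘ.≃-trans (toℚᵘ-/ (+ m) p) (ℚᵘ.≃-trans
      (ℚᵘ.*≡* (trans (sym (pos-* m q)) (trans (cong +_ mq≡np) (pos-* n p))))
      (ℚᵘ.≃-sym (toℚᵘ-/ (+ n) q))))

  m/p+n/q≡[mq+np]/pq : ∀ m n p q .{{_ : NonZero p}} .{{_ : NonZero q}} →
                       + m / p + + n / q ≡ (+ (m ℕ.* q ℕ.+ n ℕ.* p) / (p ℕ.* q)) {{m*n≢0 p q}}
  m/p+n/q≡[mq+np]/pq m n p@(suc _) q@(suc _) =
    toℚᵘ-injective (ℚᵘ.≃-trans (toℚᵘ-homo-+ (+ m / p) (+ n / q)) (ℚᵘ.≃-trans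
      (ℚᵘ.+-cong (toℚᵘ-/ (+ m) p) (toℚᵘ-/ (+ n) q))
      (ℚᵘ.≃-trans (ℚᵘ.≃-reflexive (cong (λ i → i ℚᵘ./ (p ℕ.* q)) numerator))
      (ℚᵘ.≃-sym (toℚᵘ-/ (+ (m ℕ.* q ℕ.+ n ℕ.* p)) (p ℕ.* q))))))
    where
    numerator : + m ℤ.* + q ℤ.+ + n ℤ.* + p ≡ + (m ℕ.* q ℕ.+ n ℕ.* p)
    numerator = sym (trans (pos-+ (m ℕ.* q) (n ℕ.* p)) (cong₂ ℤ._+_ (pos-* m q) (pos-* n p)))

module PartialSums where

  open import Data.Nat as ℕ using (ℕ; zero; suc; _^_)
  open import Data.Nat.Properties using (m^n≢0; m*n≢0)
  open import Data.Nat.Tactic.RingSolver using (solve-∀)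
  open import Data.Integer using (+_)
  open import Data.Rational using (_/_; _+_)
  open import Relation.Binary.PropositionalEquality
  open Words
  open Fractions

  τPartial≡tmWord/2^ : ∀ N → τPartial N ≡ (+ tmWord 0 N / 2 ^ N) {{m^n≢0 2 N}}
  τPartial≡tmWord/2^ zero    = refl
  τPartial≡tmWord/2^ (suc N) = begin
    τPartial N + + t N / 2 ^ suc N
      ≡⟨ cong (_+ + t N / 2 ^ suc N) (τPartial≡tmWord/2^ N) ⟩
    + a / 2 ^ N + + t N / 2 ^ suc N
      ≡⟨ m/p+n/q≡[mq+np]/pq a (t N) (2 ^ N) (2 ^ suc N) ⟩
    + b / (2 ^ N ℕ.* 2 ^ suc N)
      ≡⟨ m*q≡n*p⇒m/p≡n/q b (tmWord 0 (suc N)) (2 ^ N ℕ.* 2 ^ suc N) (2 ^ suc N) (identity a (t N) (2 ^ N)) ⟩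
    + tmWord 0 (suc N) / 2 ^ suc N
      ∎
    where
    open ≡-Reasoning
    instance
      _ = m^n≢0 2 N
      _ = m^n≢0 2 (suc N)
      _ = m*n≢0 (2 ^ N) (2 ^ suc N)
    a b : ℕ
    a = tmWord 0 N
    b = a ℕ.* 2 ^ suc N ℕ.+ t N ℕ.* 2 ^ N
    identity : ∀ a d x → (a ℕ.* (2 ℕ.* x) ℕ.+ d ℕ.* x) ℕ.* (2 ℕ.* x) ≡ (2 ℕ.* a ℕ.+ d) ℕ.* (x ℕ.* (2 ℕ.* x))
    identity = solve-∀

open import Data.Product using (∃; _×_; _,_)
open import Data.Rational using (_<_)
open import Relation.Binary.PropositionalEquality using (_≡_; sym; trans; cong; subst; subst₂)
open import Data.Nat.Properties using (m^n≢0)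
open Words using (tmWord)
open Arithmetic using (m<n⇒m*[1+n]<[1+m]*n)
open Sequences
open Fractions using (m*q<n*p⇒m/p<n/q)
open PartialSums

theorem7 : (n : ℕ) → 1 ≤ n →
    (wRatio n < sRatio n) × ∃ (λ N → sRatio n < τPartial N)
theorem7 (suc m) _ = w/E<s/F , (N , s/F<τ)
  where
  n = suc m
  open Prefix n
  N = 2 ^ suc n ℕ.+ P
  w≡u : w n ≡ u
  w≡u = w≡tmWord m
  s≡1+u : s n ≡ suc u
  s≡1+u = trans (s≡1+w m) (cong suc w≡u)
  w/E<s/F : wRatio n < sRatio n
  w/E<s/F = m*q<n*p⇒m/p<n/q (w n) (s n) (E n) (F n) {{E-nonZero n}}
    (subst₂ (λ a b → a ℕ.* F n ℕ.< b ℕ.* E n) (sym w≡u) (sym s≡1+u) (m<n⇒m*[1+n]<[1+m]*n u<E))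
  s/F<τ : sRatio n < τPartial N
  s/F<τ = subst (sRatio n <_) (sym (τPartial≡tmWord/2^ N))
    (m*q<n*p⇒m/p<n/q (s n) (tmWord 0 N) (F n) (2 ^ N) {{_}} {{m^n≢0 2 N}}
      (subst (λ a → a ℕ.* 2 ^ N ℕ.< tmWord 0 N ℕ.* F n) (sym s≡1+u) [1+u]*2^3P<tmWord-3P*F))
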